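{- Let $n,r,s,t$ be positive integers and let $F\subseteq E$ be a functional set of edges of $G_{n,r,s,t}$. Then the set of optimal edges of the subgraph $G_F=(V,F,c)$ is exactly $\mathcal{B}_F$; that is, an edge $(u,v)\in F$ satisfies $c(u,v)+y(v)=y(u)$, where $y(\cdot)$ denotes the shortest-path distance to $\mathsf{t}$ in $G_F$, if and only if $(u,v)\in\mathcal{B}_F$.
   Context: The graph $G_{n,r,s,t}=(V,E,c)$, for positive integers $n,r,s,t$ and $\epsilon=1/(rs)$: the vertex set consists of a target $\mathsf{t}$, vertices $u_i,w_i$ ($i\in[n]$), $a_{i,j,k}$ ($i\in[n],j\in[r],k\in[s]$) and $b_{i,j}$ ($i\in[n],j\in[rs]$); write $u_{n+1}=w_{n+1}=\mathsf{t}$. The edges (all distinct elements of $E$, even when parallel) are, for $i\in[n]$ and $\ell\in[t]$: $a^1_{i,j,k}:a_{i,j,k}\to a_{i,j,k+1}$ of cost $0$ ($j\in[r],k\in[s-1]$); $a^1_{i,j,s}:a_{i,j,s}\to b_{i,1}$ of cost $0$; $a^{0,\ell}_{i,j,k}:a_{i,j,k}\to u_{i+1}$ of cost $2^{2i+1}+(k-1)\epsilon$ ($j\in[r],k\in[s]$); $b^1_{i,j}:b_{i,j}\to b_{i,j+1}$ of cost $0$ ($j\in[rs-1]$); $b^1_{i,rs}:b_{i,rs}\to w_{i+1}$ of cost $0$; $b^{0,\ell}_{i,j}:b_{i,j}\to u_{i+1}$ of cost $2^{2i+1}+1+(j-1)\epsilon$ ($j\in[rs]$); $u^{1,\ell}_i:u_i\to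 b_{i,1}$ of cost $0$; $u^{0,\ell}_i:u_i\to u_{i+1}$ of cost $2^{2i}$; $w^{j,\ell}_i:w_i\to a_{i,j,1}$ of cost $0$ ($j\in[r]$); $w^{0,\ell}_i:w_i\to w_{i+1}$ of cost $2^{2i}$. Edge groups: $\mathbf{a}^1_{i,j}=\{a^1_{i,j,k}:k\in[s]\}$; $\mathbf{b}^1_i=\{b^1_{i,j}:j\in[rs]\}$; multi-edges $\mathbf{a}^0_{i,j,k}=\{a^{0,\ell}_{i,j,k}:\ell\in[t]\}$, $\mathbf{b}^0_{i,j}=\{b^{0,\ell}_{i,j}:\ell\in[t]\}$, $\mathbf{u}^1_i=\{u^{1,\ell}_i\}_{\ell}$, $\mathbf{u}^0_i=\{u^{0,\ell}_i\}_\ell$, $\mathbf{w}^j_i=\{w^{j,\ell}_i\}_\ell$ ($j\in[r]$), $\mathbf{w}^0_i=\{w^{0,\ell}_i\}_\ell$. A set $F\subseteq E$ is functional if it intersects every multi-edge. Write $\mathbf{a}^1_i\sqsubseteq F$ if $\mathbf{a}^1_{i,j}\subseteq F$ for some $j\in[r]$, and $\mathbf{a}^1_i\not\sqsubseteq F$ otherwise. Let $last(\mathbf{a}^1_{i,j},F)=\max(\{0\}\cup\{k\in[s]:a^1_{i,j,k}\notin F\})$, $last(\mathbf{b}^1_i,F)=\max(\{0\}\cup\{j\in[rs]:b^1_{i,j}\notin F\})$, and $reset(F)=\max(\{0\}\cup\{i\in[n]:\mathbf{b}^1_i\subseteq F\text{ and }\mathbf{a}^1_i\not\sqsubseteq F\})$.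 For functional $F$, $\mathcal{B}_F\subseteq F$ contains exactly the following edges. (i) For $i>reset(F)$ with $\mathbf{b}^1_i\subseteq F$: all $b^1_{i,j}$ ($j\in[rs]$); for $j\in[r],k\in[s]$: $a^1_{i,j,k}$ if $k>last(\mathbf{a}^1_{i,j},F)$ and $\mathbf{a}^0_{i,j,k}\cap F$ otherwise; $\mathbf{u}^1_i\cap F$; $\mathbf{w}^j_i\cap F$ for all $j$ with $\mathbf{a}^1_{i,j}\subseteq F$. (ii) For $i>reset(F)$ with $\mathbf{b}^1_i\not\subseteq F$: for $j\in[rs]$, $b^1_{i,j}$ if $j>last(\mathbf{b}^1_i,F)$ and $\mathbf{b}^0_{i,j}\cap F$ otherwise; $\mathbf{a}^0_{i,j,k}\cap F$ for all $j,k$; $\mathbf{u}^0_i\cap F$; $\mathbf{w}^0_i\cap F$. (iii) For $i=reset(F)$ (if $\ge1$): all $b^1_{i,j}$; for $j\in[r],k\in[s]$: $a^1_{i,j,k}$ if $k>last(\mathbf{a}^1_{i,j},F)$ and $\mathbf{a}^0_{i,j,k}\cap F$ otherwise; $\mathbf{u}^1_i\cap F$; $\mathbf{w}^0_i\cap F$. (iv) For $i<reset(F)$: $\mathbf{b}^0_{i,j}\cap F$ for all $j\in[rs]$; $\mathbf{a}^0_{i,j,k}\cap F$ for all $j,k$; $\mathbf{u}^0_i\cap F$; $\mathbf{w}^j_i\cap F$ for all $j\in[r]$. -}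

module Defs where

open import Data.Nat as ℕ using (ℕ; zero; suc; _<?_; _⊔_; _^_; NonZero; >-nonZero⁻¹)
open import Data.Nat.Properties using (m*n≢0)
open import Data.Fin using (Fin; toℕ; fromℕ<)
open import Data.List using (List; foldr; allFin)
open import Data.Bool.ListAction using (all; any)
open import Data.Bool using (Bool; true; false; _∧_; _∨_; not; if_then_else_)
open import Data.Integer using (+_)
open import Data.Rational as ℚ using (ℚ; _/_)
open import Data.Product using (Σ; ∃; _×_; _,_)
open import Relation.Binary.PropositionalEquality using (_≡_)
open import Relation.Nullary using (yes; no)

ℕ→ℚ : ℕ → ℚ
ℕ→ℚ m = + m / 1

-- The graph G_{n,r,s,t}.  All indices are 0-based Fin's: the paper's index i ∈ [n]
-- corresponds to  i : Fin n  with  toℕ i = i - 1  (likewise for j, k, ℓ).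
module G (n r s t : ℕ) {{r≢0 : NonZero r}} {{s≢0 : NonZero s}} where

  instance
    rs≢0 : NonZero (r ℕ.* s)
    rs≢0 = m*n≢0 r s

  firstB : Fin (r ℕ.* s)
  firstB = fromℕ< (>-nonZero⁻¹ (r ℕ.* s))

  data Vertex : Set where
    tV : Vertex
    uV wV : Fin n → Vertex
    aV : Fin n → Fin r → Fin s → Vertex
    bV : Fin n → Fin (r ℕ.* s) → Vertex

  data Edge : Set where
    a1 : Fin n → Fin r → Fin s → Edge
    a0 : Fin n → Fin r → Fin s → Fin t → Edge
    b1 : Fin n → Fin (r ℕ.* s) → Edge
    b0 : Fin n → Fin (r ℕ.* s) → Fin t → Edge
    u1 : Fin n → Fin t → Edge
    u0 : Fin n → Fin t → Edge
    wj : Fin n → Fin r → Fin t → Edge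
    w0 : Fin n → Fin t → Edge

  nextU nextW : Fin n → Vertex
  nextU i with suc (toℕ i) <? n
  ... | yes p = uV (fromℕ< p)
  ... | no _  = tV
  nextW i with suc (toℕ i) <? n
  ... | yes p = wV (fromℕ< p)
  ... | no _  = tV

  nextA : Fin n → Fin r → Fin s → Vertex
  nextA i j k with suc (toℕ k) <? s
  ... | yes p = aV i j (fromℕ< p)
  ... | no _  = bV i firstB

  nextB : Fin n → Fin (r ℕ.* s) → Vertex
  nextB i j with suc (toℕ j) <? r ℕ.* s
  ... | yes p = bV i (fromℕ< p)
  ... | no _  = nextW i

  src dst : Edge → Vertex
  src (a1 i j k)   = aV i j k
  src (a0 i j k ℓ) = aV i j k
  src (b1 i j)     = bV i j
  src (b0 i j ℓ)   = bV i j
  src (u1 i ℓ)     = uV i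
  src (u0 i ℓ)     = uV i
  src (wj i j ℓ)   = wV i
  src (w0 i ℓ)     = wV i
  dst (a1 i j k)   = nextA i j k
  dst (a0 i j k ℓ) = nextU i
  dst (b1 i j)     = nextB i j
  dst (b0 i j ℓ)   = nextU i
  dst (u1 i ℓ)     = bV i firstB
  dst (u0 i ℓ)     = nextU i
  dst (wj i j ℓ)   = aV i j (fromℕ< (>-nonZero⁻¹ s))
  dst (w0 i ℓ)     = nextW i

  -- ε = 1/(rs); the paper's index i is  suc (toℕ i)
  ε* : ℕ → ℚ
  ε* m = + m / (r ℕ.* s)

  cost : Edge → ℚ
  cost (a1 i j k)   = ℕ→ℚ 0
  cost (a0 i j k ℓ) = ℕ→ℚ (2 ^ (2 ℕ.* suc (toℕ i) ℕ.+ 1)) ℚ.+ ε* (toℕ k)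
  cost (b1 i j)     = ℕ→ℚ 0
  cost (b0 i j ℓ)   = ℕ→ℚ (2 ^ (2 ℕ.* suc (toℕ i) ℕ.+ 1) ℕ.+ 1) ℚ.+ ε* (toℕ j)
  cost (u1 i ℓ)     = ℕ→ℚ 0
  cost (u0 i ℓ)     = ℕ→ℚ (2 ^ (2 ℕ.* suc (toℕ i)))
  cost (wj i j ℓ)   = ℕ→ℚ 0
  cost (w0 i ℓ)     = ℕ→ℚ (2 ^ (2 ℕ.* suc (toℕ i)))

  _∈F_ : Edge → (Edge → Bool) → Set
  e ∈F F = F e ≡ true

  -- F intersects every multi-edge
  Functional : (Edge → Bool) → Set
  Functional F =
      (∀ i j k → ∃ λ ℓ → a0 i j k ℓ ∈F F)
    × (∀ i j → ∃ λ ℓ → b0 i j ℓ ∈F F)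
    × (∀ i → ∃ λ ℓ → u1 i ℓ ∈F F)
    × (∀ i → ∃ λ ℓ → u0 i ℓ ∈F F)
    × (∀ i j → ∃ λ ℓ → wj i j ℓ ∈F F)
    × (∀ i → ∃ λ ℓ → w0 i ℓ ∈F F)

  data Path (F : Edge → Bool) : Vertex → Set where
    done : Path F tV
    step : (e : Edge) → e ∈F F → Path F (dst e) → Path F (src e)

  pathCost : ∀ {F v} → Path F v → ℚ
  pathCost done         = ℕ→ℚ 0
  pathCost (step e _ p) = cost e ℚ.+ pathCost p

  IsDist : (Edge → Bool) → (Vertex → ℚ) → Set
  IsDist F y = ∀ v →
      (Σ (Path F v) λ p → pathCost p ≡ y v)
    × (∀ (p : Path F v) → y v ℚ.≤ pathCost p)

  module _ (F : Edge → Bool) where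

    aFull : Fin n → Fin r → Bool
    aFull i j = all (λ k → F (a1 i j k)) (allFin s)

    aSq : Fin n → Bool
    aSq i = any (aFull i) (allFin r)

    bFull : Fin n → Bool
    bFull i = all (λ j → F (b1 i j)) (allFin (r ℕ.* s))

    -- last(𝐚^1_{i,j},F), last(𝐛^1_i,F), values in {0,…,s} resp. {0,…,rs} (1-based)
    lastA : Fin n → Fin r → ℕ
    lastA i j = foldr (λ k acc → if F (a1 i j k) then acc else suc (toℕ k) ⊔ acc) 0 (allFin s)

    lastB : Fin n → ℕ
    lastB i = foldr (λ j acc → if F (b1 i j) then acc else suc (toℕ j) ⊔ acc) 0 (allFin (r ℕ.* s))

    -- reset(F) ∈ {0,…,n} (1-based)
    reset : ℕ
    reset = foldr (λ i acc → if bFull i ∧ not (aSq i) then suc (toℕ i) ⊔ acc else acc) 0 (allFin n)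

    data Regime : Set where
      caseI caseII caseIII caseIV : Regime

    regime : Fin n → Regime
    regime i with reset ℕ.<? suc (toℕ i) | suc (toℕ i) ℕ.<? reset
    ... | yes _ | _     = if bFull i then caseI else caseII
    ... | no _  | yes _ = caseIV
    ... | no _  | no _  = caseIII

    isI isII isIII isIV : Fin n → Bool
    isI i   with regime i
    ... | caseI = true
    ... | _     = false
    isII i  with regime i
    ... | caseII = true
    ... | _      = false
    isIII i with regime i
    ... | caseIII = true
    ... | _       = false
    isIV i  with regime i
    ... | caseIV = true
    ... | _      = false

    -- k > last  (k, j given 0-based)
    aAfterLast : Fin n → Fin r → Fin s → Bool
    aAfterLast i j k with lastA i j ℕ.<? suc (toℕ k)
    ... | yes _ = true
    ... | no _  = false

    bAfterLast : Fin n → Fin (r ℕ.* s) → Bool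
    bAfterLast i j with lastB i ℕ.<? suc (toℕ j)
    ... | yes _ = true
    ... | no _  = false

    inB : Edge → Bool
    inB (a1 i j k)   = (isI i ∨ isIII i) ∧ aAfterLast i j k
    inB (a0 i j k ℓ) = F (a0 i j k ℓ) ∧
                         (((isI i ∨ isIII i) ∧ not (aAfterLast i j k)) ∨ isII i ∨ isIV i)
    inB (b1 i j)     = isI i ∨ isIII i ∨ (isII i ∧ bAfterLast i j)
    inB (b0 i j ℓ)   = F (b0 i j ℓ) ∧ ((isII i ∧ not (bAfterLast i j)) ∨ isIV i)
    inB (u1 i ℓ)     = F (u1 i ℓ) ∧ (isI i ∨ isIII i)
    inB (u0 i ℓ)     = F (u0 i ℓ) ∧ (isII i ∨ isIV i)
    inB (wj i j ℓ)   = F (wj i j ℓ) ∧ ((isI i ∧ aFull i j) ∨ isIV i)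
    inB (w0 i ℓ)     = F (w0 i ℓ) ∧ (isII i ∨ isIII i)

  𝓑 : (Edge → Bool) → Edge → Set
  𝓑 F e = inB F e ≡ true

-- Multiplied by rs = ε⁻¹, the distances in G_F become natural numbers Φ with an explicit formula:
-- u_i lies 2^{2i}·rs above u_{i+1} when i is in case (ii) or (iv) and level with it otherwise,
-- w_i lies a further 2^{2i}·rs above u_i in cases (iii) and (iv), and a vertex of an a- or b-chain
-- lies level with u_{i+1} when its chain edge is in 𝓑_F and otherwise above it by the cost of its
-- parallel exit.  Checking the edges of F case by case shows that Φ satisfies the triangle
-- inequality, with equality exactly on 𝓑_F.  Every vertex other than 𝗍 has an out-edge in F ∩ 𝓑_F
-- and every edge decreases a rank, so following 𝓑_F realises Φ.  Hence y = Φ/rs, and an edge is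
-- optimal iff it is tight for Φ iff it lies in 𝓑_F.
module Submission where

open import Defs
open import Data.Nat using (ℕ; NonZero)
open import Data.Bool using (Bool)
open import Data.Rational using (ℚ; _+_)
open import Relation.Binary.PropositionalEquality using (_≡_)
open import Function.Bundles using (_⇔_)

open import Data.Nat as ℕ using (zero; suc; _≤_; _<_; z≤n; s≤s; _<?_; _≤?_; _∸_; _^_; _⊔_; >-nonZero⁻¹)
import Data.Nat.Properties as ℕP
open import Data.Nat.Tactic.RingSolver using (solve-∀)
open import Data.Integer as ℤ using (+_; +≤+)
import Data.Integer.Properties as ℤP
import Data.Integer.Tactic.RingSolver as ℤ-Solver
open import Data.Rational as ℚ using (_/_; toℚᵘ)
import Data.Rational.Properties as ℚP
open import Data.Rational.Unnormalised as ℚᵘ using (mkℚᵘ; *≡*; *≤*)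
import Data.Rational.Unnormalised.Properties as ℚᵘP
open import Data.Bool using (true; false; _∧_; _∨_; not; if_then_else_; T)
open import Data.Bool.ListAction using (all; any)
import Data.Bool.Properties as BoolP
open import Data.Fin using (Fin; toℕ; fromℕ<)
import Data.Fin.Properties as FinP
open import Data.List using (List; []; _∷_; foldr; allFin)
open import Data.List.Membership.Propositional using (_∈_; lose)
open import Data.List.Membership.Propositional.Properties using (∈-allFin)
open import Data.List.Relation.Unary.Any using (here; there; satisfied)
import Data.List.Relation.Unary.All as All
open import Data.List.Relation.Unary.All.Properties using (all⁺; all⁻)
open import Data.List.Relation.Unary.Any.Properties using (any⁺; any⁻)
open import Data.Product using (Σ; ∃; _×_; _,_; proj₁; proj₂)
open import Data.Sum using (_⊎_; inj₁; inj₂; [_,_])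
open import Function.Base using (_∘_)
open import Function.Bundles using (mk⇔; Equivalence)
open import Relation.Binary.PropositionalEquality using (refl; sym; trans; cong; cong₂; subst; subst₂; module ≡-Reasoning)
open import Relation.Nullary using (¬_; yes; no; contradiction)
open import Relation.Nullary.Decidable using (isYes)
open import Relation.Nullary.Reflects using (Reflects; ofʸ; ofⁿ)

infix 8 _/ᴺ_

_/ᴺ_ : ℕ → (d : ℕ) .{{_ : NonZero d}} → ℚ
a /ᴺ d = + a / d

private
  toℚᵘ-/ᴺ : ∀ a d → toℚᵘ (a /ᴺ suc d) ℚᵘ.≃ mkℚᵘ (+ a) d
  toℚᵘ-/ᴺ a d = ℚP.toℚᵘ-fromℚᵘ (mkℚᵘ (+ a) d)

/ᴺ-mono-≤ : ∀ {a b} d .{{_ : NonZero d}} → a ≤ b → a /ᴺ d ℚ.≤ b /ᴺ d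
/ᴺ-mono-≤ {a} {b} (suc d) a≤b = ℚP.toℚᵘ-cancel-≤
  (ℚᵘP.≤-respˡ-≃ (ℚᵘP.≃-sym (toℚᵘ-/ᴺ a d)) (ℚᵘP.≤-respʳ-≃ (ℚᵘP.≃-sym (toℚᵘ-/ᴺ b d))
    (*≤* (ℤP.*-monoʳ-≤-nonNeg (+ suc d) (+≤+ a≤b)))))

/ᴺ-cancel-≤ : ∀ {a b} d .{{_ : NonZero d}} → a /ᴺ d ℚ.≤ b /ᴺ d → a ≤ b
/ᴺ-cancel-≤ {a} {b} (suc d) a≤b
  with *≤* le ← ℚᵘP.≤-respˡ-≃ (toℚᵘ-/ᴺ a d) (ℚᵘP.≤-respʳ-≃ (toℚᵘ-/ᴺ b d) (ℚP.toℚᵘ-mono-≤ a≤b))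
  with +≤+ a≤b′ ← ℤP.*-cancelʳ-≤-pos (+ a) (+ b) (+ suc d) le = a≤b′

/ᴺ-injective : ∀ {a b} d .{{_ : NonZero d}} → a /ᴺ d ≡ b /ᴺ d → a ≡ b
/ᴺ-injective d eq = ℕP.≤-antisym (/ᴺ-cancel-≤ d (ℚP.≤-reflexive eq)) (/ᴺ-cancel-≤ d (ℚP.≤-reflexive (sym eq)))

+-/ᴺ : ∀ a b d .{{_ : NonZero d}} → a /ᴺ d ℚ.+ b /ᴺ d ≡ (a ℕ.+ b) /ᴺ d
+-/ᴺ a b (suc d) = ℚP.toℚᵘ-injective (begin-equality
  toℚᵘ (a /ᴺ suc d ℚ.+ b /ᴺ suc d)          ≃⟨ ℚP.toℚᵘ-homo-+ (a /ᴺ suc d) (b /ᴺ suc d) ⟩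
  toℚᵘ (a /ᴺ suc d) ℚᵘ.+ toℚᵘ (b /ᴺ suc d)   ≃⟨ ℚᵘP.+-cong (toℚᵘ-/ᴺ a d) (toℚᵘ-/ᴺ b d) ⟩
  mkℚᵘ (+ a) d ℚᵘ.+ mkℚᵘ (+ b) d            ≃⟨ *≡* (trans (ring (+ a) (+ b) (+ suc d))
                                                         (cong (ℤ._* (+ suc d ℤ.* + suc d)) (sym (ℤP.pos-+ a b)))) ⟩
  mkℚᵘ (+ (a ℕ.+ b)) d                      ≃⟨ ℚᵘP.≃-sym (toℚᵘ-/ᴺ (a ℕ.+ b) d) ⟩
  toℚᵘ ((a ℕ.+ b) /ᴺ suc d)                 ∎)
  where
  open ℚᵘP.≤-Reasoning
  ring : ∀ x y z → (x ℤ.* z ℤ.+ y ℤ.* z) ℤ.* z ≡ (x ℤ.+ y) ℤ.* (z ℤ.* z)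
  ring = ℤ-Solver.solve-∀

ℕ→ℚ-/ᴺ : ∀ m d .{{_ : NonZero d}} → ℕ→ℚ m ≡ (m ℕ.* d) /ᴺ d
ℕ→ℚ-/ᴺ m (suc d) = ℚP.toℚᵘ-injective (ℚᵘP.≃-trans (toℚᵘ-/ᴺ m 0)
  (ℚᵘP.≃-trans (*≡* (trans (sym (ℤP.pos-* m (suc d))) (sym (ℤP.*-identityʳ _))))
               (ℚᵘP.≃-sym (toℚᵘ-/ᴺ (m ℕ.* suc d) d))))

ℕ→ℚ+/ᴺ : ∀ m a d .{{_ : NonZero d}} → ℕ→ℚ m ℚ.+ a /ᴺ d ≡ (m ℕ.* d ℕ.+ a) /ᴺ d
ℕ→ℚ+/ᴺ m a d = trans (cong (ℚ._+ a /ᴺ d) (ℕ→ℚ-/ᴺ m d)) (+-/ᴺ (m ℕ.* d) a d)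

private
  T⇒≡ : ∀ {b} → T b → b ≡ true
  T⇒≡ = Equivalence.to BoolP.T-≡

  ≡⇒T : ∀ {b} → b ≡ true → T b
  ≡⇒T = Equivalence.from BoolP.T-≡

module _ {m : ℕ} where

  all-allFin : (P : Fin m → Bool) → all P (allFin m) ≡ true ⇔ (∀ k → P k ≡ true)
  all-allFin P = mk⇔
    (λ allP k → T⇒≡ (All.lookup (all⁺ P (allFin m) (≡⇒T allP)) (∈-allFin k)))
    (λ P-everywhere → T⇒≡ (all⁻ P {allFin m} (All.tabulate λ {k} _ → ≡⇒T (P-everywhere k))))

  any-allFin : (P : Fin m → Bool) → any P (allFin m) ≡ true ⇔ ∃ λ k → P k ≡ true
  any-allFin P = mk⇔
    (λ anyP → let k , Pk = satisfied (any⁻ P (allFin m) (≡⇒T anyP)) in k , T⇒≡ Pk)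
    (λ (k , Pk) → T⇒≡ (any⁺ P (lose (∈-allFin k) (≡⇒T Pk))))

  -- `reset F` is `lastTrue resetCandidate`, and `lastA F i j`, `lastB F i` are `lastFalse` of
  -- their rows, all definitionally.
  lastTrueIn : (Fin m → Bool) → List (Fin m) → ℕ
  lastTrueIn P = foldr (λ k acc → if P k then suc (toℕ k) ⊔ acc else acc) 0

  lastTrue lastFalse : (Fin m → Bool) → ℕ
  lastTrue  P = lastTrueIn P (allFin m)
  lastFalse P = foldr (λ k acc → if P k then acc else suc (toℕ k) ⊔ acc) 0 (allFin m)

  lastFalse≡lastTrue∘not : (P : Fin m → Bool) → lastFalse P ≡ lastTrue (not ∘ P)
  lastFalse≡lastTrue∘not P = go (allFin m)
    where
    go : ∀ xs → foldr (λ k acc → if P k then acc else suc (toℕ k) ⊔ acc) 0 xs ≡ lastTrueIn (not ∘ P) xs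
    go []       = refl
    go (k ∷ xs) with P k
    ... | true  = go xs
    ... | false = cong (suc (toℕ k) ⊔_) (go xs)

  module _ (P : Fin m → Bool) where

    lastTrue-bound : ∀ {k} → P k ≡ true → toℕ k < lastTrue P
    lastTrue-bound {k} Pk = go (∈-allFin k)
      where
      go : ∀ {xs} → k ∈ xs → toℕ k < lastTrueIn P xs
      go {x ∷ xs} (here refl) rewrite Pk = ℕP.m≤m⊔n (suc (toℕ k)) (lastTrueIn P xs)
      go {x ∷ xs} (there k∈xs) with P x
      ... | true  = ℕP.≤-trans (go k∈xs) (ℕP.m≤n⊔m (suc (toℕ x)) (lastTrueIn P xs))
      ... | false = go k∈xs

    lastTrue-least : ∀ {b} → (∀ k → P k ≡ true → toℕ k < b) → lastTrue P ≤ b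
    lastTrue-least {b} below = go (allFin m)
      where
      go : ∀ xs → lastTrueIn P xs ≤ b
      go []       = z≤n
      go (k ∷ xs) with P k in Pk
      ... | true  = ℕP.⊔-lub (below k Pk) (go xs)
      ... | false = go xs

    lastTrue≤ : lastTrue P ≤ m
    lastTrue≤ = lastTrue-least (λ k _ → FinP.toℕ<n k)

    lastTrue-skip : ∀ {k} → P k ≡ false → lastTrue P ≤ suc (toℕ k) → lastTrue P ≤ toℕ k
    lastTrue-skip {k} Pk last≤k+1 = lastTrue-least λ k′ Pk′ →
      ℕP.≤∧≢⇒< (ℕP.≤-pred (ℕP.<-≤-trans (lastTrue-bound Pk′) last≤k+1))
               (λ k′≡k → BoolP.not-¬ Pk (trans (cong P (sym (FinP.toℕ-injective k′≡k))) Pk′))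

  module _ (P : Fin m → Bool) where

    lastFalse≤⇒true : ∀ {k} → lastFalse P ≤ toℕ k → P k ≡ true
    lastFalse≤⇒true {k} last≤k rewrite lastFalse≡lastTrue∘not P with P k in Pk
    ... | true  = refl
    ... | false = contradiction (ℕP.<-≤-trans (lastTrue-bound (not ∘ P) (cong not Pk)) last≤k) (ℕP.n≮n (toℕ k))

    lastFalse-skip : ∀ {k} → P k ≡ true → lastFalse P ≤ suc (toℕ k) → lastFalse P ≤ toℕ k
    lastFalse-skip Pk rewrite lastFalse≡lastTrue∘not P = lastTrue-skip (not ∘ P) (cong not Pk)

    lastFalse≤ : lastFalse P ≤ m
    lastFalse≤ rewrite lastFalse≡lastTrue∘not P = lastTrue≤ (not ∘ P)

    all⇒lastFalse≤0 : all P (allFin m) ≡ true → lastFalse P ≤ 0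
    all⇒lastFalse≤0 allP rewrite lastFalse≡lastTrue∘not P =
      lastTrue-least (not ∘ P) λ k notPk →
        contradiction notPk (BoolP.not-¬ (cong not (Equivalence.to (all-allFin P) allP k)))

  module AfterLastFalse (P : Fin m → Bool) (after : Fin m → Bool)
                        (after-reflects : ∀ k → Reflects (lastFalse P ≤ toℕ k) (after k)) where

    private
      after⇒≤ : ∀ {k} → after k ≡ true → lastFalse P ≤ toℕ k
      after⇒≤ {k} with after k | after-reflects k
      ... | true | ofʸ last≤k = λ _ → last≤k

      ≤⇒after : ∀ {k} → lastFalse P ≤ toℕ k → after k ≡ true
      ≤⇒after {k} with after k | after-reflects k
      ... | true  | _          = λ _ → refl
      ... | false | ofⁿ last≰k = λ last≤k → contradiction last≤k last≰k

      ≰⇒¬after : ∀ {k} → ¬ lastFalse P ≤ toℕ k → after k ≡ false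
      ≰⇒¬after {k} with after k | after-reflects k
      ... | true  | ofʸ last≤k = λ last≰k → contradiction last≤k last≰k
      ... | false | _          = λ _ → refl

    after⇒true : ∀ {k} → after k ≡ true → P k ≡ true
    after⇒true = lastFalse≤⇒true P ∘ after⇒≤

    after-suc : ∀ {k} (k+1<m : suc (toℕ k) < m) → after k ≡ true → after (fromℕ< k+1<m) ≡ true
    after-suc k+1<m afterk = ≤⇒after (subst (lastFalse P ≤_) (sym (FinP.toℕ-fromℕ< k+1<m))
                                            (ℕP.m≤n⇒m≤1+n (after⇒≤ afterk)))

    ¬after-suc : ∀ {k} (k+1<m : suc (toℕ k) < m) → P k ≡ true → after k ≡ false → after (fromℕ< k+1<m) ≡ false
    ¬after-suc {k} k+1<m Pk ¬afterk = ≰⇒¬after λ last≤k+1 →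
      BoolP.not-¬ (≤⇒after (lastFalse-skip P Pk (subst (lastFalse P ≤_) (FinP.toℕ-fromℕ< k+1<m) last≤k+1)))
                  ¬afterk

    after-final : ∀ {k} → P k ≡ true → ¬ suc (toℕ k) < m → after k ≡ true
    after-final Pk k-final = ≤⇒after (lastFalse-skip P Pk (ℕP.≤-trans (lastFalse≤ P) (ℕP.≮⇒≥ k-final)))

    all⇒after : ∀ {k} → all P (allFin m) ≡ true → after k ≡ true
    all⇒after allP = ≤⇒after (ℕP.≤-trans (all⇒lastFalse≤0 P allP) z≤n)

    ¬all⇒¬after : ∀ {k} → toℕ k ≡ 0 → all P (allFin m) ≡ false → after k ≡ false
    ¬all⇒¬after {k} k≡0 ¬allP = ≰⇒¬after λ last≤k →
      BoolP.not-¬ (Equivalence.from (all-allFin P)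
                     (λ k′ → lastFalse≤⇒true P (ℕP.≤-trans (subst (lastFalse P ≤_) k≡0 last≤k) z≤n)))
                  ¬allP

module Potentials (n r s t : ℕ) {{_ : NonZero r}} {{_ : NonZero s}} (F : G.Edge n r s t → Bool) where
  open G n r s t

  module _ (φ : Vertex → ℚ) where

    Feasible : Set
    Feasible = φ tV ℚ.≤ ℕ→ℚ 0 × (∀ e → e ∈F F → φ (src e) ℚ.≤ cost e ℚ.+ φ (dst e))

    feasible⇒≤pathCost : Feasible → ∀ {v} (p : Path F v) → φ v ℚ.≤ pathCost p
    feasible⇒≤pathCost (φt≤0 , _)     done         = φt≤0
    feasible⇒≤pathCost feas@(_ , tri) (step e e∈F p) =
      ℚP.≤-trans (tri e e∈F) (ℚP.+-monoʳ-≤ (cost e) (feasible⇒≤pathCost feas p))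

    TightEdgeFrom : Vertex → Set
    TightEdgeFrom v = Σ Edge λ e → src e ≡ v × e ∈F F × cost e ℚ.+ φ (dst e) ≡ φ v

    PathOfCost : Vertex → Set
    PathOfCost v = Σ (Path F v) λ p → pathCost p ≡ φ v

    tightPath : φ tV ≡ ℕ→ℚ 0 → (rank : Vertex → ℕ) → (∀ e → rank (dst e) < rank (src e)) →
                (∀ v → v ≡ tV ⊎ TightEdgeFrom v) → ∀ v → PathOfCost v
    tightPath φt≡0 rank descends tightFrom v = go (suc (rank v)) v (ℕP.n<1+n (rank v))
      where
      go : ∀ fuel v → rank v < fuel → PathOfCost v
      go (suc fuel) v rank<fuel with tightFrom v
      ... | inj₁ refl = done , sym φt≡0
      ... | inj₂ (e , refl , e∈F , tight) =
        let p , cost-p = go fuel (dst e) (ℕP.<-≤-trans (descends e) (ℕP.≤-pred rank<fuel))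
        in step e e∈F p , trans (cong (cost e ℚ.+_) cost-p) tight

    distance≡potential : ∀ {y} → IsDist F y → Feasible → (∀ v → PathOfCost v) → ∀ v → y v ≡ φ v
    distance≡potential {y} dist feas tightPaths v =
      let p , cost-p = tightPaths v
          q , cost-q = proj₁ (dist v)
      in ℚP.≤-antisym (subst (y v ℚ.≤_) cost-p (proj₂ (dist v) p))
                      (subst (φ v ℚ.≤_) cost-q (feasible⇒≤pathCost feas q))

module OptimalEdges (n r s t : ℕ) {{_ : NonZero r}} {{_ : NonZero s}} (F : G.Edge n r s t → Bool) where
  open G n r s t
  open Potentials n r s t F

  resetCandidate : Fin n → Bool
  resetCandidate i = bFull F i ∧ not (aSq F i)

  data RegimeSpec (i : Fin n) : Regime F → Set where
    specI   : bFull F i ≡ true  → aSq F i ≡ true  → RegimeSpec i caseI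
    specII  : bFull F i ≡ false → RegimeSpec i caseII
    specIII : bFull F i ≡ true  → aSq F i ≡ false → RegimeSpec i caseIII
    specIV  : RegimeSpec i caseIV

  regimeSpec : ∀ i → RegimeSpec i (regime F i)
  regimeSpec i with reset F <? suc (toℕ i) | suc (toℕ i) <? reset F
  ... | yes reset<i+1 | _ with bFull F i in full | aSq F i in sq
  ...   | true  | true  = specI full sq
  ...   | true  | false = contradiction (lastTrue-bound resetCandidate (cong₂ (λ b a → b ∧ not a) full sq))
                                        (ℕP.≤⇒≯ (ℕP.≤-pred reset<i+1))
  ...   | false | _     = specII full
  regimeSpec i | no _ | yes _ = specIV
  regimeSpec i | no reset≮i+1 | no i+1≮reset with bFull F i in full | aSq F i in sq
  ... | true  | false = specIII full sq
  ... | true  | true  =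
    contradiction (s≤s (lastTrue-skip resetCandidate (cong₂ (λ b a → b ∧ not a) full sq) (ℕP.≮⇒≥ i+1≮reset)))
                  reset≮i+1
  ... | false | _     =
    contradiction (s≤s (lastTrue-skip resetCandidate (cong (_∧ not (aSq F i)) full) (ℕP.≮⇒≥ i+1≮reset)))
                  reset≮i+1

  isIV≡ : ∀ i → isIV F i ≡ isYes (suc (toℕ i) <? reset F)
  isIV≡ i with reset F <? suc (toℕ i) | suc (toℕ i) <? reset F
  ... | yes reset<i+1 | yes i+1<reset = contradiction (ℕP.<-trans reset<i+1 i+1<reset) (ℕP.n≮n _)
  ... | yes _ | no _ with bFull F i
  ...   | true  = refl
  ...   | false = refl
  isIV≡ i | no _ | yes _ = refl
  isIV≡ i | no _ | no _  = refl

  isIII∨isIV≡ : ∀ i → isIII F i ∨ isIV F i ≡ isYes (suc (toℕ i) ≤? reset F)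
  isIII∨isIV≡ i with reset F <? suc (toℕ i) | suc (toℕ i) <? reset F | suc (toℕ i) ≤? reset F
  ... | yes reset<i+1 | _ | yes i+1≤reset = contradiction (ℕP.<-≤-trans reset<i+1 i+1≤reset) (ℕP.n≮n _)
  ... | yes _ | _ | no _ with bFull F i
  ...   | true  = refl
  ...   | false = refl
  isIII∨isIV≡ i | no _ | yes _ | yes _ = refl
  isIII∨isIV≡ i | no _ | no _  | yes _ = refl
  isIII∨isIV≡ i | no reset≮i+1 | _ | no i+1≰reset = contradiction (ℕP.≮⇒≥ reset≮i+1) i+1≰reset

  aAfterLast-reflects : ∀ i j k → Reflects (lastA F i j ≤ toℕ k) (aAfterLast F i j k)
  aAfterLast-reflects i j k with lastA F i j <? suc (toℕ k)
  ... | yes last<k+1 = ofʸ (ℕP.≤-pred last<k+1)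
  ... | no  last≮k+1 = ofⁿ (last≮k+1 ∘ s≤s)

  bAfterLast-reflects : ∀ i j → Reflects (lastB F i ≤ toℕ j) (bAfterLast F i j)
  bAfterLast-reflects i j with lastB F i <? suc (toℕ j)
  ... | yes last<j+1 = ofʸ (ℕP.≤-pred last<j+1)
  ... | no  last≮j+1 = ofⁿ (last≮j+1 ∘ s≤s)

  module AChain (i : Fin n) (j : Fin r) =
    AfterLastFalse (λ k → F (a1 i j k)) (aAfterLast F i j) (aAfterLast-reflects i j)
  module BChain (i : Fin n) =
    AfterLastFalse (λ j → F (b1 i j)) (bAfterLast F i) (bAfterLast-reflects i)

  firstA : Fin s
  firstA = fromℕ< (>-nonZero⁻¹ s)

  toℕ-firstA : toℕ firstA ≡ 0
  toℕ-firstA = FinP.toℕ-fromℕ< (>-nonZero⁻¹ s)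

  toℕ-firstB : toℕ firstB ≡ 0
  toℕ-firstB = FinP.toℕ-fromℕ< (>-nonZero⁻¹ (r ℕ.* s))

  ¬aSq⇒¬aFull : ∀ {i} j → aSq F i ≡ false → aFull F i j ≡ false
  ¬aSq⇒¬aFull {i} j ¬sq with aFull F i j in full
  ... | true  = contradiction (Equivalence.from (any-allFin (aFull F i)) (j , full)) (BoolP.not-¬ ¬sq)
  ... | false = refl

  D : ℕ
  D = r ℕ.* s

  weight : Fin n → ℕ
  weight i = 2 ^ (2 ℕ.* suc (toℕ i)) ℕ.* D

  aCost : Fin n → Fin s → ℕ
  aCost i k = 2 ℕ.* weight i ℕ.+ toℕ k

  bCost : Fin n → Fin D → ℕ
  bCost i j = 2 ℕ.* weight i ℕ.+ (D ℕ.+ toℕ j)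

  costᴺ : Edge → ℕ
  costᴺ (a1 i j k)   = 0
  costᴺ (a0 i j k ℓ) = aCost i k
  costᴺ (b1 i j)     = 0
  costᴺ (b0 i j ℓ)   = bCost i j
  costᴺ (u1 i ℓ)     = 0
  costᴺ (u0 i ℓ)     = weight i
  costᴺ (wj i j ℓ)   = 0
  costᴺ (w0 i ℓ)     = weight i

  2^[m+1]*D : ∀ m → 2 ^ (m ℕ.+ 1) ℕ.* D ≡ 2 ℕ.* (2 ^ m ℕ.* D)
  2^[m+1]*D m = trans (cong (ℕ._* D) (ℕP.^-distribˡ-+-* 2 m 1)) (ring (2 ^ m) D)
    where
    ring : ∀ y d → y ℕ.* 2 ℕ.* d ≡ 2 ℕ.* (y ℕ.* d)
    ring = solve-∀

  cost≡costᴺ/D : ∀ e → cost e ≡ costᴺ e /ᴺ D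
  cost≡costᴺ/D (a1 i j k)   = ℕ→ℚ-/ᴺ 0 D
  cost≡costᴺ/D (a0 i j k ℓ) =
    trans (ℕ→ℚ+/ᴺ (2 ^ (m ℕ.+ 1)) (toℕ k) D) (cong (λ x → (x ℕ.+ toℕ k) /ᴺ D) (2^[m+1]*D m))
    where
    m : ℕ
    m = 2 ℕ.* suc (toℕ i)
  cost≡costᴺ/D (b1 i j)     = ℕ→ℚ-/ᴺ 0 D
  cost≡costᴺ/D (b0 i j ℓ)   =
    trans (ℕ→ℚ+/ᴺ (2 ^ (m ℕ.+ 1) ℕ.+ 1) (toℕ j) D)
          (cong (_/ᴺ D) (trans (ring (2 ^ (m ℕ.+ 1)) D (toℕ j)) (cong (ℕ._+ (D ℕ.+ toℕ j)) (2^[m+1]*D m))))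
    where
    m : ℕ
    m = 2 ℕ.* suc (toℕ i)
    ring : ∀ y d x → (y ℕ.+ 1) ℕ.* d ℕ.+ x ≡ y ℕ.* d ℕ.+ (d ℕ.+ x)
    ring = solve-∀
  cost≡costᴺ/D (u1 i ℓ)     = ℕ→ℚ-/ᴺ 0 D
  cost≡costᴺ/D (u0 i ℓ)     = ℕ→ℚ-/ᴺ (2 ^ (2 ℕ.* suc (toℕ i))) D
  cost≡costᴺ/D (wj i j ℓ)   = ℕ→ℚ-/ᴺ 0 D
  cost≡costᴺ/D (w0 i ℓ)     = ℕ→ℚ-/ᴺ (2 ^ (2 ℕ.* suc (toℕ i))) D

  uExtra wExtra : Fin n → ℕ
  uExtra i = if isII F i ∨ isIV F i then weight i else 0
  wExtra i = if isIII F i ∨ isIV F i then weight i else 0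

  uExtraAt : ℕ → ℕ
  uExtraAt m with m <? n
  ... | yes m<n = uExtra (fromℕ< m<n)
  ... | no  _   = 0

  uExtraSum : ℕ → ℕ → ℕ
  uExtraSum m zero    = 0
  uExtraSum m (suc h) = uExtraAt m ℕ.+ uExtraSum (suc m) h

  uPot : ℕ → ℕ
  uPot m = uExtraSum m (n ∸ m)

  n∸i≡1+n∸[1+i] : ∀ (i : Fin n) → n ∸ toℕ i ≡ suc (n ∸ suc (toℕ i))
  n∸i≡1+n∸[1+i] i = ℕP.+-∸-assoc 1 (FinP.toℕ<n i)

  uPot-step : ∀ i → uPot (toℕ i) ≡ uExtra i ℕ.+ uPot (suc (toℕ i))
  uPot-step i rewrite n∸i≡1+n∸[1+i] i with toℕ i <? n
  ... | yes i<n = cong (λ i′ → uExtra i′ ℕ.+ uPot (suc (toℕ i))) (FinP.fromℕ<-toℕ i i<n)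
  ... | no  i≮n = contradiction (FinP.toℕ<n i) i≮n

  uPot-top : ∀ {m} → n ≤ m → uPot m ≡ 0
  uPot-top n≤m rewrite ℕP.m≤n⇒m∸n≡0 n≤m = refl

  weight-next : ∀ {i i′} → toℕ i′ ≡ suc (toℕ i) → weight i′ ≡ 4 ℕ.* weight i
  weight-next {i} i′≡i+1 rewrite i′≡i+1 =
    trans (cong (λ m → 2 ^ m ℕ.* D) (ring₁ (toℕ i))) (ring₂ (2 ^ (2 ℕ.* suc (toℕ i))) D)
    where
    ring₁ : ∀ x → 2 ℕ.* suc (suc x) ≡ 2 ℕ.+ 2 ℕ.* suc x
    ring₁ = solve-∀
    ring₂ : ∀ y d → 2 ℕ.* (2 ℕ.* y) ℕ.* d ≡ 4 ℕ.* (y ℕ.* d)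
    ring₂ = solve-∀

  wExtra-next : ∀ {i i′} → toℕ i′ ≡ suc (toℕ i) → wExtra i′ ≡ (if isIV F i then 4 ℕ.* weight i else 0)
  wExtra-next {i} {i′} i′≡i+1 = cong₂ (λ b w → if b then w else 0) regime-next (weight-next i′≡i+1)
    where
    regime-next : isIII F i′ ∨ isIV F i′ ≡ isIV F i
    regime-next = trans (isIII∨isIV≡ i′)
                        (trans (cong (λ m → isYes (suc m ≤? reset F)) i′≡i+1) (sym (isIV≡ i)))

  isIV-top : ∀ {i} → ¬ suc (toℕ i) < n → isIV F i ≡ false
  isIV-top {i} i-top rewrite isIV≡ i with suc (toℕ i) <? reset F
  ... | yes i<reset = contradiction (ℕP.<-≤-trans i<reset (lastTrue≤ resetCandidate)) i-top
  ... | no  _       = refl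

  private
    ≡+0 : ∀ c → c ≡ c ℕ.+ 0
    ≡+0 c = sym (ℕP.+-identityʳ c)

  -- above i = Φ (nextU i); every vertex of level i sits at above i plus a local offset.
  above : Fin n → ℕ
  above i = uPot (suc (toℕ i))

  Φ : Vertex → ℕ
  Φ tV         = 0
  Φ (uV i)     = above i ℕ.+ uExtra i
  Φ (wV i)     = above i ℕ.+ (uExtra i ℕ.+ wExtra i)
  Φ (aV i j k) = above i ℕ.+ (if inB F (a1 i j k) then 0 else aCost i k)
  Φ (bV i j)   = above i ℕ.+ (if inB F (b1 i j) then 0 else bCost i j)

  Φ-level : ∀ i → above i ℕ.+ uExtra i ≡ uPot (toℕ i)
  Φ-level i = trans (ℕP.+-comm (above i) (uExtra i)) (sym (uPot-step i))

  Φ-nextU : ∀ i → Φ (nextU i) ≡ above i ℕ.+ 0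
  Φ-nextU i with suc (toℕ i) <? n
  ... | yes i+1<n =
    trans (Φ-level (fromℕ< i+1<n)) (trans (cong uPot (FinP.toℕ-fromℕ< i+1<n)) (≡+0 (above i)))
  ... | no  i-top = sym (trans (ℕP.+-identityʳ (above i)) (uPot-top (ℕP.≮⇒≥ i-top)))

  Φ-nextW : ∀ i → Φ (nextW i) ≡ above i ℕ.+ (if isIV F i then 4 ℕ.* weight i else 0)
  Φ-nextW i with suc (toℕ i) <? n
  ... | yes i+1<n = begin
    above i′ ℕ.+ (uExtra i′ ℕ.+ wExtra i′)   ≡⟨ ℕP.+-assoc (above i′) (uExtra i′) (wExtra i′) ⟨
    above i′ ℕ.+ uExtra i′ ℕ.+ wExtra i′     ≡⟨ cong (ℕ._+ wExtra i′) (Φ-level i′) ⟩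
    uPot (toℕ i′) ℕ.+ wExtra i′              ≡⟨ cong₂ ℕ._+_ (cong uPot i′≡i+1) (wExtra-next i′≡i+1) ⟩
    above i ℕ.+ (if isIV F i then 4 ℕ.* weight i else 0) ∎
    where
    open ≡-Reasoning
    i′ : Fin n
    i′ = fromℕ< i+1<n
    i′≡i+1 : toℕ i′ ≡ suc (toℕ i)
    i′≡i+1 = FinP.toℕ-fromℕ< i+1<n
  ... | no i-top rewrite isIV-top i-top =
    sym (trans (ℕP.+-identityʳ (above i)) (uPot-top (ℕP.≮⇒≥ i-top)))

  module _ (i : Fin n) where

    private instance
      2^≢0 : NonZero (2 ^ (2 ℕ.* suc (toℕ i)))
      2^≢0 = ℕP.m^n≢0 2 (2 ℕ.* suc (toℕ i))

    weight>0 : 0 < weight i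
    weight>0 = >-nonZero⁻¹ (weight i) {{ℕP.m*n≢0 (2 ^ (2 ℕ.* suc (toℕ i))) D}}

    D≤weight : D ≤ weight i
    D≤weight = ℕP.m≤n*m D (2 ^ (2 ℕ.* suc (toℕ i)))

    weight<4*weight : weight i < 4 ℕ.* weight i
    weight<4*weight = ℕP.m<m+n (weight i) (ℕP.<-≤-trans weight>0 (ℕP.m≤m+n (weight i) _))

    weight<2*weight+ : ∀ x → weight i < 2 ℕ.* weight i ℕ.+ x
    weight<2*weight+ x = ℕP.<-≤-trans (ℕP.m<m+n (weight i) weight>0)
                                       (ℕP.≤-trans (ℕP.+-monoʳ-≤ (weight i) (ℕP.m≤m+n (weight i) 0)) (ℕP.m≤m+n _ x))

    0<2*weight+ : ∀ x → 0 < 2 ℕ.* weight i ℕ.+ x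
    0<2*weight+ x = ℕP.<-trans weight>0 (weight<2*weight+ x)

    aCost<aCost-next : ∀ {k} (k+1<s : suc (toℕ k) < s) → aCost i k < aCost i (fromℕ< k+1<s)
    aCost<aCost-next k+1<s = ℕP.+-monoʳ-< (2 ℕ.* weight i) (ℕP.≤-reflexive (sym (FinP.toℕ-fromℕ< k+1<s)))

    bCost<bCost-next : ∀ {j} (j+1<D : suc (toℕ j) < D) → bCost i j < bCost i (fromℕ< j+1<D)
    bCost<bCost-next j+1<D =
      ℕP.+-monoʳ-< (2 ℕ.* weight i) (ℕP.+-monoʳ-< D (ℕP.≤-reflexive (sym (FinP.toℕ-fromℕ< j+1<D))))

    aCost<bCost : ∀ k j → aCost i k < bCost i j
    aCost<bCost k j = ℕP.+-monoʳ-< (2 ℕ.* weight i)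
      (ℕP.<-≤-trans (FinP.toℕ<n k) (ℕP.≤-trans (ℕP.m≤n*m s r) (ℕP.m≤m+n D (toℕ j))))

    bCost<4*weight : ∀ j → bCost i j < 4 ℕ.* weight i
    bCost<4*weight j = begin-strict
      2 ℕ.* weight i ℕ.+ (D ℕ.+ toℕ j)   <⟨ ℕP.+-monoʳ-< (2 ℕ.* weight i) (ℕP.+-monoʳ-< D (FinP.toℕ<n j)) ⟩
      2 ℕ.* weight i ℕ.+ (D ℕ.+ D)       ≤⟨ ℕP.+-monoʳ-≤ (2 ℕ.* weight i)
                                              (ℕP.+-mono-≤ D≤weight (ℕP.≤-trans D≤weight (ℕP.m≤m+n (weight i) 0))) ⟩
      2 ℕ.* weight i ℕ.+ 2 ℕ.* weight i  ≡⟨ ring (weight i) ⟩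
      4 ℕ.* weight i                     ∎
      where
      open ℕP.≤-Reasoning
      ring : ∀ w → 2 ℕ.* w ℕ.+ 2 ℕ.* w ≡ 4 ℕ.* w
      ring = solve-∀

  Optimality : Edge → Set
  Optimality e = inB F e ≡ true  × Φ (src e) ≡ costᴺ e ℕ.+ Φ (dst e)
               ⊎ inB F e ≡ false × Φ (src e) < costᴺ e ℕ.+ Φ (dst e)

  pattern tight inB≡true  Φ-tight = inj₁ (inB≡true  , Φ-tight)
  pattern slack inB≡false Φ-slack = inj₂ (inB≡false , Φ-slack)

  private
    shift : ∀ x c b → x ℕ.+ (c ℕ.+ b) ≡ c ℕ.+ (x ℕ.+ b)
    shift = solve-∀

    shift-≡ : ∀ x c {a b} → a ≡ c ℕ.+ b → x ℕ.+ a ≡ c ℕ.+ (x ℕ.+ b)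
    shift-≡ x c {b = b} a≡c+b = trans (cong (x ℕ.+_) a≡c+b) (shift x c b)

    shift-< : ∀ x c {a b} → a < c ℕ.+ b → x ℕ.+ a < c ℕ.+ (x ℕ.+ b)
    shift-< x c {a} {b} a<c+b = subst (x ℕ.+ a <_) (shift x c b) (ℕP.+-monoʳ-< x a<c+b)

    shift₀-≡ : ∀ x c {a} → a ≡ c → x ℕ.+ a ≡ c ℕ.+ (x ℕ.+ 0)
    shift₀-≡ x c a≡c = shift-≡ x c (trans a≡c (≡+0 c))

    shift₀-< : ∀ x c {a} → a < c → x ℕ.+ a < c ℕ.+ (x ℕ.+ 0)
    shift₀-< x c {a} a<c = shift-< x c (subst (a <_) (≡+0 c) a<c)

  optimal-a1 : ∀ i j k → F (a1 i j k) ≡ true → Optimality (a1 i j k)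
  optimal-a1 i j k a1∈F with suc (toℕ k) <? s
  ... | yes k+1<s with regime F i | regimeSpec i
  ...   | caseI   | _ with aAfterLast F i j k in after
  ...     | true  rewrite AChain.after-suc i j k+1<s after = tight refl refl
  ...     | false rewrite AChain.¬after-suc i j k+1<s a1∈F after =
    slack refl (ℕP.+-monoʳ-< (above i) (aCost<aCost-next i k+1<s))
  optimal-a1 i j k a1∈F | yes k+1<s | caseIII | _ with aAfterLast F i j k in after
  ...     | true  rewrite AChain.after-suc i j k+1<s after = tight refl refl
  ...     | false rewrite AChain.¬after-suc i j k+1<s a1∈F after =
    slack refl (ℕP.+-monoʳ-< (above i) (aCost<aCost-next i k+1<s))
  optimal-a1 i j k a1∈F | yes k+1<s | caseII  | _ = slack refl (ℕP.+-monoʳ-< (above i) (aCost<aCost-next i k+1<s))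
  optimal-a1 i j k a1∈F | yes k+1<s | caseIV  | _ = slack refl (ℕP.+-monoʳ-< (above i) (aCost<aCost-next i k+1<s))
  optimal-a1 i j k a1∈F | no k-final with regime F i | regimeSpec i
  ...   | caseI   | _ rewrite AChain.after-final i j a1∈F k-final = tight refl refl
  ...   | caseIII | _ rewrite AChain.after-final i j a1∈F k-final = tight refl refl
  ...   | caseII  | specII ¬full
    rewrite BChain.¬all⇒¬after i toℕ-firstB ¬full = slack refl (ℕP.+-monoʳ-< (above i) (aCost<bCost i k firstB))
  ...   | caseIV  | _ = slack refl (ℕP.+-monoʳ-< (above i) (aCost<bCost i k firstB))

  optimal-a0 : ∀ i j k ℓ → F (a0 i j k ℓ) ≡ true → Optimality (a0 i j k ℓ)
  optimal-a0 i j k ℓ a0∈F rewrite a0∈F | Φ-nextU i with regime F i | regimeSpec i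
  ... | caseI   | _ with aAfterLast F i j k
  ...   | true  = slack refl (shift₀-< (above i) (aCost i k) (0<2*weight+ i (toℕ k)))
  ...   | false = tight refl (shift₀-≡ (above i) (aCost i k) refl)
  optimal-a0 i j k ℓ a0∈F | caseIII | _ with aAfterLast F i j k
  ...   | true  = slack refl (shift₀-< (above i) (aCost i k) (0<2*weight+ i (toℕ k)))
  ...   | false = tight refl (shift₀-≡ (above i) (aCost i k) refl)
  optimal-a0 i j k ℓ a0∈F | caseII  | _ = tight refl (shift₀-≡ (above i) (aCost i k) refl)
  optimal-a0 i j k ℓ a0∈F | caseIV  | _ = tight refl (shift₀-≡ (above i) (aCost i k) refl)

  optimal-b1 : ∀ i j → F (b1 i j) ≡ true → Optimality (b1 i j)
  optimal-b1 i j b1∈F with suc (toℕ j) <? D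
  ... | yes j+1<D with regime F i | regimeSpec i
  ...   | caseI   | _ = tight refl refl
  ...   | caseIII | _ = tight refl refl
  ...   | caseIV  | _ = slack refl (ℕP.+-monoʳ-< (above i) (bCost<bCost-next i j+1<D))
  ...   | caseII  | _ with bAfterLast F i j in after
  ...     | true  rewrite BChain.after-suc i j+1<D after = tight refl refl
  ...     | false rewrite BChain.¬after-suc i j+1<D b1∈F after =
    slack refl (ℕP.+-monoʳ-< (above i) (bCost<bCost-next i j+1<D))
  optimal-b1 i j b1∈F | no j-final rewrite Φ-nextW i with regime F i | regimeSpec i
  ...   | caseI   | _ = tight refl refl
  ...   | caseIII | _ = tight refl refl
  ...   | caseIV  | _ = slack refl (ℕP.+-monoʳ-< (above i) (bCost<4*weight i j))
  ...   | caseII  | _ rewrite BChain.after-final i b1∈F j-final = tight refl refl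

  optimal-b0 : ∀ i j ℓ → F (b0 i j ℓ) ≡ true → Optimality (b0 i j ℓ)
  optimal-b0 i j ℓ b0∈F rewrite b0∈F | Φ-nextU i with regime F i | regimeSpec i
  ... | caseI   | _ = slack refl (shift₀-< (above i) (bCost i j) (0<2*weight+ i (D ℕ.+ toℕ j)))
  ... | caseIII | _ = slack refl (shift₀-< (above i) (bCost i j) (0<2*weight+ i (D ℕ.+ toℕ j)))
  ... | caseIV  | _ = tight refl (shift₀-≡ (above i) (bCost i j) refl)
  ... | caseII  | _ with bAfterLast F i j
  ...   | true  = slack refl (shift₀-< (above i) (bCost i j) (0<2*weight+ i (D ℕ.+ toℕ j)))
  ...   | false = tight refl (shift₀-≡ (above i) (bCost i j) refl)

  optimal-u1 : ∀ i ℓ → F (u1 i ℓ) ≡ true → Optimality (u1 i ℓ)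
  optimal-u1 i ℓ u1∈F rewrite u1∈F with regime F i | regimeSpec i
  ... | caseI   | _ = tight refl refl
  ... | caseIII | _ = tight refl refl
  ... | caseIV  | _ = slack refl (ℕP.+-monoʳ-< (above i) (weight<2*weight+ i (D ℕ.+ toℕ firstB)))
  ... | caseII  | specII ¬full rewrite BChain.¬all⇒¬after i toℕ-firstB ¬full =
    slack refl (ℕP.+-monoʳ-< (above i) (weight<2*weight+ i (D ℕ.+ toℕ firstB)))

  optimal-u0 : ∀ i ℓ → F (u0 i ℓ) ≡ true → Optimality (u0 i ℓ)
  optimal-u0 i ℓ u0∈F rewrite u0∈F | Φ-nextU i with regime F i | regimeSpec i
  ... | caseI   | _ = slack refl (shift₀-< (above i) (weight i) (weight>0 i))
  ... | caseIII | _ = slack refl (shift₀-< (above i) (weight i) (weight>0 i))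
  ... | caseII  | _ = tight refl (shift₀-≡ (above i) (weight i) refl)
  ... | caseIV  | _ = tight refl (shift₀-≡ (above i) (weight i) refl)

  optimal-wj : ∀ i j ℓ → F (wj i j ℓ) ≡ true → Optimality (wj i j ℓ)
  optimal-wj i j ℓ wj∈F rewrite wj∈F with regime F i | regimeSpec i
  ... | caseI   | _ with aFull F i j in full
  ...   | true  rewrite AChain.all⇒after i j {firstA} full = tight refl refl
  ...   | false rewrite AChain.¬all⇒¬after i j toℕ-firstA full =
    slack refl (ℕP.+-monoʳ-< (above i) (0<2*weight+ i (toℕ firstA)))
  optimal-wj i j ℓ wj∈F | caseII  | _ =
    slack refl (ℕP.+-monoʳ-< (above i) (subst (_< aCost i firstA) (≡+0 (weight i)) (weight<2*weight+ i (toℕ firstA))))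
  optimal-wj i j ℓ wj∈F | caseIII | specIII _ ¬sq
    rewrite AChain.¬all⇒¬after i j toℕ-firstA (¬aSq⇒¬aFull j ¬sq) =
    slack refl (ℕP.+-monoʳ-< (above i) (weight<2*weight+ i (toℕ firstA)))
  optimal-wj i j ℓ wj∈F | caseIV  | _ rewrite toℕ-firstA = tight refl (cong (above i ℕ.+_) (ring (weight i)))
    where
    ring : ∀ w → w ℕ.+ w ≡ 2 ℕ.* w ℕ.+ 0
    ring = solve-∀

  optimal-w0 : ∀ i ℓ → F (w0 i ℓ) ≡ true → Optimality (w0 i ℓ)
  optimal-w0 i ℓ w0∈F rewrite w0∈F | Φ-nextW i with regime F i | regimeSpec i
  ... | caseI   | _ = slack refl (shift₀-< (above i) (weight i) (weight>0 i))
  ... | caseII  | _ = tight refl (shift-≡ (above i) (weight i) refl)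
  ... | caseIII | _ = tight refl (shift₀-≡ (above i) (weight i) refl)
  ... | caseIV  | _ = slack refl (shift-< (above i) (weight i) (ℕP.+-monoʳ-< (weight i) (weight<4*weight i)))

  optimal : ∀ e → e ∈F F → Optimality e
  optimal (a1 i j k)   = optimal-a1 i j k
  optimal (a0 i j k ℓ) = optimal-a0 i j k ℓ
  optimal (b1 i j)     = optimal-b1 i j
  optimal (b0 i j ℓ)   = optimal-b0 i j ℓ
  optimal (u1 i ℓ)     = optimal-u1 i ℓ
  optimal (u0 i ℓ)     = optimal-u0 i ℓ
  optimal (wj i j ℓ)   = optimal-wj i j ℓ
  optimal (w0 i ℓ)     = optimal-w0 i ℓ

  𝓑-from-u : ∀ i ℓ ℓ′ → u1 i ℓ ∈F F → u0 i ℓ′ ∈F F → 𝓑 F (u1 i ℓ) ⊎ 𝓑 F (u0 i ℓ′)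
  𝓑-from-u i ℓ ℓ′ u1∈F u0∈F rewrite u1∈F | u0∈F with regime F i
  ... | caseI   = inj₁ refl
  ... | caseII  = inj₂ refl
  ... | caseIII = inj₁ refl
  ... | caseIV  = inj₂ refl

  𝓑-from-w : ∀ i ℓ (ℓs : Fin r → Fin t) → w0 i ℓ ∈F F → (∀ j → wj i j (ℓs j) ∈F F) →
             𝓑 F (w0 i ℓ) ⊎ ∃ λ j → 𝓑 F (wj i j (ℓs j))
  𝓑-from-w i ℓ ℓs w0∈F wj∈F rewrite w0∈F with regime F i | regimeSpec i
  ... | caseI   | specI _ sq = let j , full = Equivalence.to (any-allFin (aFull F i)) sq
                               in inj₂ (j , cong₂ (λ x y → x ∧ (y ∨ false)) (wj∈F j) full)
  ... | caseII  | _ = inj₁ refl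
  ... | caseIII | _ = inj₁ refl
  ... | caseIV  | _ = inj₂ (firstR , cong (_∧ true) (wj∈F firstR))
    where
    firstR : Fin r
    firstR = fromℕ< (>-nonZero⁻¹ r)

  𝓑-from-a : ∀ i j k ℓ → a0 i j k ℓ ∈F F → (a1 i j k ∈F F × 𝓑 F (a1 i j k)) ⊎ 𝓑 F (a0 i j k ℓ)
  𝓑-from-a i j k ℓ a0∈F rewrite a0∈F with regime F i
  ... | caseI with aAfterLast F i j k in after
  ...   | true  = inj₁ (AChain.after⇒true i j after , refl)
  ...   | false = inj₂ refl
  𝓑-from-a i j k ℓ a0∈F | caseIII with aAfterLast F i j k in after
  ...   | true  = inj₁ (AChain.after⇒true i j after , refl)
  ...   | false = inj₂ refl
  𝓑-from-a i j k ℓ a0∈F | caseII = inj₂ refl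
  𝓑-from-a i j k ℓ a0∈F | caseIV = inj₂ refl

  𝓑-from-b : ∀ i j ℓ → b0 i j ℓ ∈F F → (b1 i j ∈F F × 𝓑 F (b1 i j)) ⊎ 𝓑 F (b0 i j ℓ)
  𝓑-from-b i j ℓ b0∈F rewrite b0∈F with regime F i | regimeSpec i
  ... | caseI   | specI full _    = inj₁ (BChain.after⇒true i (BChain.all⇒after i full) , refl)
  ... | caseIII | specIII full _  = inj₁ (BChain.after⇒true i (BChain.all⇒after i full) , refl)
  ... | caseIV  | _ = inj₂ refl
  ... | caseII  | _ with bAfterLast F i j in after
  ...   | true  = inj₁ (BChain.after⇒true i after , refl)
  ...   | false = inj₂ refl

  -- Levels are ranked from the top; inside a level w > a_{j,1} > … > a_{j,s} > u > b_1 > … > b_rs,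
  -- and M exceeds every in-level rank.
  M : ℕ
  M = D ℕ.+ s ℕ.+ 3

  levelRank : Fin n → ℕ
  levelRank i = (n ∸ suc (toℕ i)) ℕ.* M

  rank : Vertex → ℕ
  rank tV         = 0
  rank (bV i j)   = levelRank i ℕ.+ (D ∸ toℕ j)
  rank (aV i j k) = levelRank i ℕ.+ (suc D ℕ.+ (s ∸ toℕ k))
  rank (uV i)     = levelRank i ℕ.+ suc D
  rank (wV i)     = levelRank i ℕ.+ (D ℕ.+ s ℕ.+ 2)

  levelRank-next : ∀ {i i′ x} → toℕ i′ ≡ suc (toℕ i) → x ≤ M → levelRank i′ ℕ.+ x ≤ levelRank i
  levelRank-next {i} {i′} {x} i′≡i+1 x≤M = begin
    levelRank i′ ℕ.+ x                    ≤⟨ ℕP.+-monoʳ-≤ (levelRank i′) x≤M ⟩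
    levelRank i′ ℕ.+ M                    ≡⟨ ℕP.+-comm (levelRank i′) M ⟩
    suc (n ∸ suc (toℕ i′)) ℕ.* M          ≡⟨ cong (ℕ._* M) (n∸i≡1+n∸[1+i] i′) ⟨
    (n ∸ toℕ i′) ℕ.* M                    ≡⟨ cong (λ m → (n ∸ m) ℕ.* M) i′≡i+1 ⟩
    levelRank i                           ∎
    where open ℕP.≤-Reasoning

  rank-nextU : ∀ i → rank (nextU i) ≤ levelRank i
  rank-nextU i with suc (toℕ i) <? n
  ... | yes i+1<n =
    levelRank-next (FinP.toℕ-fromℕ< i+1<n) (ℕP.≤-trans (ℕP.m≤m+n (suc D) (s ℕ.+ 2)) (ℕP.≤-reflexive (ring D s)))
    where
    ring : ∀ d s → suc d ℕ.+ (s ℕ.+ 2) ≡ d ℕ.+ s ℕ.+ 3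
    ring = solve-∀
  ... | no  _     = z≤n

  rank-nextW : ∀ i → rank (nextW i) ≤ levelRank i
  rank-nextW i with suc (toℕ i) <? n
  ... | yes i+1<n = levelRank-next (FinP.toℕ-fromℕ< i+1<n) (ℕP.+-monoʳ-≤ (D ℕ.+ s) (ℕP.n≤1+n 2))
  ... | no  _     = z≤n

  private
    below-level : ∀ i {x y} → y ≤ levelRank i → 0 < x → y < levelRank i ℕ.+ x
    below-level i {x} y≤ 0<x = ℕP.≤-<-trans y≤ (ℕP.m<m+n (levelRank i) 0<x)

  rank-descends : ∀ e → rank (dst e) < rank (src e)
  rank-descends (a1 i j k) with suc (toℕ k) <? s
  ... | yes k+1<s rewrite FinP.toℕ-fromℕ< k+1<s =
    ℕP.+-monoʳ-< (levelRank i) (ℕP.+-monoʳ-< (suc D) (ℕP.∸-monoʳ-< (ℕP.n<1+n (toℕ k)) (ℕP.<⇒≤ k+1<s)))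
  ... | no  _ rewrite toℕ-firstB = ℕP.+-monoʳ-< (levelRank i) (ℕP.m≤m+n (suc D) _)
  rank-descends (a0 i j k ℓ) = below-level i (rank-nextU i) ℕ.z<s
  rank-descends (b1 i j) with suc (toℕ j) <? D
  ... | yes j+1<D rewrite FinP.toℕ-fromℕ< j+1<D =
    ℕP.+-monoʳ-< (levelRank i) (ℕP.∸-monoʳ-< (ℕP.n<1+n (toℕ j)) (ℕP.<⇒≤ j+1<D))
  ... | no  _ = below-level i (rank-nextW i) (ℕP.m<n⇒0<n∸m (FinP.toℕ<n j))
  rank-descends (b0 i j ℓ) = below-level i (rank-nextU i) (ℕP.m<n⇒0<n∸m (FinP.toℕ<n j))
  rank-descends (u1 i ℓ) rewrite toℕ-firstB = ℕP.+-monoʳ-< (levelRank i) (ℕP.n<1+n D)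
  rank-descends (u0 i ℓ) = below-level i (rank-nextU i) ℕ.z<s
  rank-descends (wj i j ℓ) rewrite toℕ-firstA =
    ℕP.+-monoʳ-< (levelRank i) (ℕP.≤-reflexive (ring D s))
    where
    ring : ∀ d s → suc (suc d ℕ.+ s) ≡ d ℕ.+ s ℕ.+ 2
    ring = solve-∀
  rank-descends (w0 i ℓ) = below-level i (rank-nextW i) (ℕP.<-≤-trans ℕ.z<s (ℕP.m≤n+m 2 (D ℕ.+ s)))

  φ : Vertex → ℚ
  φ v = Φ v /ᴺ D

  cost+φ≡ : ∀ e → cost e ℚ.+ φ (dst e) ≡ (costᴺ e ℕ.+ Φ (dst e)) /ᴺ D
  cost+φ≡ e = trans (cong (ℚ._+ φ (dst e)) (cost≡costᴺ/D e)) (+-/ᴺ (costᴺ e) (Φ (dst e)) D)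

  φ-tV : φ tV ≡ ℕ→ℚ 0
  φ-tV = sym (ℕ→ℚ-/ᴺ 0 D)

  φ-feasible : Feasible φ
  φ-feasible = ℚP.≤-reflexive φ-tV ,
               λ e e∈F → subst (φ (src e) ℚ.≤_) (sym (cost+φ≡ e)) (/ᴺ-mono-≤ D (Φ-triangle e e∈F))
    where
    Φ-triangle : ∀ e → e ∈F F → Φ (src e) ≤ costᴺ e ℕ.+ Φ (dst e)
    Φ-triangle e e∈F with optimal e e∈F
    ... | tight _ Φ-tight = ℕP.≤-reflexive Φ-tight
    ... | slack _ Φ-slack = ℕP.<⇒≤ Φ-slack

  𝓑⇒tight : ∀ e → e ∈F F → 𝓑 F e → TightEdgeFrom φ (src e)
  𝓑⇒tight e e∈F e∈𝓑 with optimal e e∈F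
  ... | tight _ Φ-tight = e , refl , e∈F , trans (cost+φ≡ e) (cong (_/ᴺ D) (sym Φ-tight))
  ... | slack e∉𝓑 _    = contradiction e∈𝓑 (BoolP.not-¬ e∉𝓑)

  tight-from : Functional F → ∀ v → v ≡ tV ⊎ TightEdgeFrom φ v
  tight-from _ tV = inj₁ refl
  tight-from (_ , _ , has-u1 , has-u0 , _ , _) (uV i) =
    let ℓ , u1∈F = has-u1 i ; ℓ′ , u0∈F = has-u0 i
    in inj₂ ([ 𝓑⇒tight (u1 i ℓ) u1∈F , 𝓑⇒tight (u0 i ℓ′) u0∈F ] (𝓑-from-u i ℓ ℓ′ u1∈F u0∈F))
  tight-from (_ , _ , _ , _ , has-wj , has-w0) (wV i) =
    let ℓ , w0∈F = has-w0 i
    in inj₂ ([ 𝓑⇒tight (w0 i ℓ) w0∈F , (λ (j , wj∈𝓑) → 𝓑⇒tight (wj i j _) (proj₂ (has-wj i j)) wj∈𝓑) ]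
               (𝓑-from-w i ℓ (proj₁ ∘ has-wj i) w0∈F (proj₂ ∘ has-wj i)))
  tight-from (has-a0 , _) (aV i j k) =
    let ℓ , a0∈F = has-a0 i j k
    in inj₂ ([ (λ (a1∈F , a1∈𝓑) → 𝓑⇒tight (a1 i j k) a1∈F a1∈𝓑) , 𝓑⇒tight (a0 i j k ℓ) a0∈F ]
               (𝓑-from-a i j k ℓ a0∈F))
  tight-from (_ , has-b0 , _) (bV i j) =
    let ℓ , b0∈F = has-b0 i j
    in inj₂ ([ (λ (b1∈F , b1∈𝓑) → 𝓑⇒tight (b1 i j) b1∈F b1∈𝓑) , 𝓑⇒tight (b0 i j ℓ) b0∈F ]
               (𝓑-from-b i j ℓ b0∈F))

  distance≡φ : Functional F → ∀ {y} → IsDist F y → ∀ v → y v ≡ φ v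
  distance≡φ functional dist =
    distance≡potential φ dist φ-feasible (tightPath φ φ-tV rank rank-descends (tight-from functional))

  optimal⇔𝓑 : ∀ e → e ∈F F → (cost e ℚ.+ φ (dst e) ≡ φ (src e)) ⇔ 𝓑 F e
  optimal⇔𝓑 e e∈F rewrite cost+φ≡ e with optimal e e∈F
  ... | tight e∈𝓑 Φ-tight = mk⇔ (λ _ → e∈𝓑) (λ _ → cong (_/ᴺ D) (sym Φ-tight))
  ... | slack e∉𝓑 Φ-slack = mk⇔ (λ φ-tight → contradiction (/ᴺ-injective D φ-tight) (ℕP.>⇒≢ Φ-slack))
                                (λ e∈𝓑 → contradiction e∈𝓑 (BoolP.not-¬ e∉𝓑))

mainTheorem6 : (n r s t : ℕ) → {{_ : NonZero n}} → {{_ : NonZero r}} → {{_ : NonZero s}} → {{_ : NonZero t}} →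
    let open G n r s t in
    (F : Edge → Bool) → Functional F →
    (y : Vertex → ℚ) → IsDist F y →
    (e : Edge) → e ∈F F →
    ((cost e + y (dst e) ≡ y (src e)) ⇔ 𝓑 F e)
mainTheorem6 n r s t F functional y dist e e∈F =
  subst₂ (λ y-dst y-src → (cost e + y-dst ≡ y-src) ⇔ 𝓑 F e) (sym (y≡φ (dst e))) (sym (y≡φ (src e)))
         (optimal⇔𝓑 e e∈F)
  where
  open G n r s t
  open OptimalEdges n r s t F
  y≡φ : ∀ v → y v ≡ φ v
  y≡φ = distance≡φ functional dist
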